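{- Let $k$ be a positive integer. Every twin-free finite simple graph $G$ with $b_2(G) \leq k$ is isomorphic to an induced subgraph of $B_k$.
   Context: For a finite simple graph $G=(V,E)$, a biclique on a subset of $V$ is given by two disjoint sets $X,Y\subseteq V$; its edges are all pairs $\{x,y\}$ with $x\in X$, $y\in Y$. An odd cover of $G$ is a collection of bicliques on subsets of $V$ such that every pair of vertices adjacent in $G$ is an edge of an odd number of the bicliques, and every pair of distinct non-adjacent vertices is an edge of an even number of the bicliques. $b_2(G)$ denotes the minimum cardinality of an odd cover of $G$. A graph is twin-free if there are no two distinct vertices $u,v$ with $N(u)=N(v)$, where $N(\cdot)$ is the open neighborhood. The graph $B_k$ has as vertex set all strings of length $k$ over the alphabet $\{0,1,\varepsilon\}$, and two strings $u,v$ are adjacent iff the number of positions $i$ in which one of $u,v$ has $0$ and the other has $1$ is odd. -}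

module Defs where

open import Data.Nat using (ℕ; zero; suc)
open import Data.Bool using (Bool; true; false; _∧_; _∨_; _xor_; not)
open import Data.Fin using (Fin)
open import Data.Vec using (Vec; []; _∷_)
open import Data.List using (List; []; _∷_; length)
open import Data.Empty using (⊥)
open import Relation.Binary.PropositionalEquality using (_≡_)
open import Relation.Nullary using (¬_)

record Graph : Set where
  field
    n      : ℕ
    adj    : Fin n → Fin n → Bool
    sym    : ∀ u v → adj u v ≡ adj v u
    irrefl : ∀ u → adj u u ≡ false
open Graph public

record Biclique (n : ℕ) : Set where
  field
    X Y      : Fin n → Bool
    disjoint : ∀ v → X v ∧ Y v ≡ false
open Biclique public

isEdge : ∀ {n} → Biclique n → Fin n → Fin n → Bool
isEdge B u v = (X B u ∧ Y B v) ∨ (X B v ∧ Y B u)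

edgeParity : ∀ {n} → List (Biclique n) → Fin n → Fin n → Bool
edgeParity []       u v = false
edgeParity (B ∷ Bs) u v = isEdge B u v xor edgeParity Bs u v

IsOddCover : (G : Graph) → List (Biclique (n G)) → Set
IsOddCover G C = ∀ u v → ¬ (u ≡ v) → edgeParity C u v ≡ adj G u v

b₂≤ : Graph → ℕ → Set
b₂≤ G k = Σ (List (Biclique (n G))) (λ C → IsOddCover G C × length C ≤ k)
  where
  open import Data.Product using (Σ; _×_)
  open import Data.Nat using (_≤_)

TwinFree : Graph → Set
TwinFree G = ∀ u v → (∀ w → adj G u w ≡ adj G v w) → u ≡ v

data Sym : Set where
  s0 s1 sε : Sym

clash : Sym → Sym → Bool
clash s0 s1 = true
clash s1 s0 = true
clash _  _  = false

adjB : ∀ {k} → Vec Sym k → Vec Sym k → Bool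
adjB []       []       = false
adjB (a ∷ as) (b ∷ bs) = clash a b xor adjB as bs

IsoInducedSubgraphOfB : Graph → ℕ → Set
IsoInducedSubgraphOfB G k =
  Σ (Fin (n G) → Vec Sym k) λ f →
    (∀ u v → f u ≡ f v → u ≡ v) × (∀ u v → adjB (f u) (f v) ≡ adj G u v)
  where
  open import Data.Product using (Σ; _×_)

-- Write the odd cover as B₁, …, Bₘ with m ≤ k and send a vertex v to the
-- string whose i-th letter is 0 if v ∈ Xᵢ, 1 if v ∈ Yᵢ and ε otherwise,
-- padded with ε up to length k. Position i is a 0/1 clash for u and v exactly
-- when {u, v} is an edge of Bᵢ, so adjacency in B_k is the parity with which
-- the cover hits {u, v}, i.e. adjacency in G. Two vertices with the same
-- string then have the same neighbourhood, so twin-freeness makes the map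
-- injective.
module Submission where

open import Defs
open import Data.Nat using (ℕ; _≤_; suc; s≤s)
open import Data.Bool using (Bool; true; false; _∧_; _∨_; _xor_)
open import Data.Fin using (Fin; _≟_)
open import Data.Vec using (Vec; []; _∷_; replicate)
open import Data.List using (List; []; _∷_; length)
open import Data.Product using (_,_)
open import Relation.Binary.PropositionalEquality
  using (_≡_; refl; trans; cong; cong₂) renaming (sym to ≡-sym)
open import Relation.Nullary using (¬_; yes; no)

sideSym : Bool → Bool → Sym
sideSym true  _     = s0
sideSym false true  = s1
sideSym false false = sε

clash-sideSym : ∀ xu yu xv yv → xu ∧ yu ≡ false → xv ∧ yv ≡ false →
  clash (sideSym xu yu) (sideSym xv yv) ≡ (xu ∧ yv) ∨ (xv ∧ yu)
clash-sideSym true  true  _     _     ()   _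
clash-sideSym _     _     true  true  _    ()
clash-sideSym true  false true  false _    _  = refl
clash-sideSym true  false false true  _    _  = refl
clash-sideSym true  false false false _    _  = refl
clash-sideSym false true  true  false _    _  = refl
clash-sideSym false true  false true  _    _  = refl
clash-sideSym false true  false false _    _  = refl
clash-sideSym false false true  false _    _  = refl
clash-sideSym false false false true  _    _  = refl
clash-sideSym false false false false _    _  = refl

bicliqueSym : ∀ {n} → Biclique n → Fin n → Sym
bicliqueSym B v = sideSym (X B v) (Y B v)

clash-bicliqueSym : ∀ {n} (B : Biclique n) u v →
  clash (bicliqueSym B u) (bicliqueSym B v) ≡ isEdge B u v
clash-bicliqueSym B u v =
  clash-sideSym (X B u) (Y B u) (X B v) (Y B v) (disjoint B u) (disjoint B v)

adjB-irrefl : ∀ {k} (w : Vec Sym k) → adjB w w ≡ false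
adjB-irrefl []       = refl
adjB-irrefl (s0 ∷ w) = adjB-irrefl w
adjB-irrefl (s1 ∷ w) = adjB-irrefl w
adjB-irrefl (sε ∷ w) = adjB-irrefl w

encode : ∀ {n} (C : List (Biclique n)) (k : ℕ) → length C ≤ k → Fin n → Vec Sym k
encode []       k       _       v = replicate k sε
encode (B ∷ Bs) (suc k) (s≤s p) v = bicliqueSym B v ∷ encode Bs k p v

adjB-encode : ∀ {n} (C : List (Biclique n)) k (p : length C ≤ k) u v →
  adjB (encode C k p u) (encode C k p v) ≡ edgeParity C u v
adjB-encode []       k       _       u v = adjB-irrefl (replicate k sε)
adjB-encode (B ∷ Bs) (suc k) (s≤s p) u v =
  cong₂ _xor_ (clash-bicliqueSym B u v) (adjB-encode Bs k p u v)

preserves-adj-on-distinct : ∀ {A : Set} (G : Graph) (R : A → A → Bool)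
  (f : Fin (n G) → A) → (∀ a → R a a ≡ false) →
  (∀ u v → ¬ u ≡ v → R (f u) (f v) ≡ adj G u v) →
  ∀ u v → R (f u) (f v) ≡ adj G u v
preserves-adj-on-distinct G R f R-irrefl pres u v with u ≟ v
... | yes refl = trans (R-irrefl (f u)) (≡-sym (irrefl G u))
... | no u≢v   = pres u v u≢v

adj-preserving-injective : ∀ {A : Set} (G : Graph) → TwinFree G →
  (R : A → A → Bool) (f : Fin (n G) → A) →
  (∀ u v → R (f u) (f v) ≡ adj G u v) →
  ∀ u v → f u ≡ f v → u ≡ v
adj-preserving-injective G twinFree R f pres u v fu≡fv = twinFree u v λ w →
  trans (≡-sym (pres u w)) (trans (cong (λ a → R a (f w)) fu≡fv) (pres v w))

proposition3p3 : (k : ℕ) → 1 ≤ k → (G : Graph) → TwinFree G → b₂≤ G k →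
    IsoInducedSubgraphOfB G k
proposition3p3 k _ G twinFree (C , oddCover , |C|≤k) =
  f , adj-preserving-injective G twinFree adjB f pres , pres
  where
  f : Fin (n G) → Vec Sym k
  f = encode C k |C|≤k

  pres : ∀ u v → adjB (f u) (f v) ≡ adj G u v
  pres = preserves-adj-on-distinct G adjB f adjB-irrefl λ u v u≢v →
    trans (adjB-encode C k |C|≤k u v) (oddCover u v u≢v)
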